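{- Let $r$ be a positive integer and let $F:\mathbf{Set}^r\to\mathbf{Set}$ be a decomposable $r$-sort species with composition operator $\eta$. Then for pairwise disjoint objects $\Omega_1,\Omega_2,\Omega_3$ of $\mathbf{Set}^r$, \[ \eta\big(\eta(F[\Omega_1]\times F[\Omega_2])\times F[\Omega_3]\big)=\eta\big(F[\Omega_1]\times\eta(F[\Omega_2]\times F[\Omega_3])\big). \]
   Context: $\mathbf{Set}$ is the category of finite sets and bijections. Objects of $\mathbf{Set}^r$ are $r$-tuples of finite sets; set operations on them are componentwise, and $\boldsymbol\emptyset=(\emptyset,\dots,\emptyset)$. An $r$-sort species is a functor $F:\mathbf{Set}^r\to\mathbf{Set}$. A composition operator for $F$ is a family of injective maps $\eta_{(\Omega_1,\Omega_2)}:F[\Omega_1]\times F[\Omega_2]\to F[\Omega_1\amalg\Omega_2]$, one for each disjoint pair, with the following two properties. - Naturality: $\eta_{(\tilde\Omega_1,\tilde\Omega_2)}\circ(F[f_1]\times F[f_2])=F[f_1\amalg f_2]\circ\eta_{(\Omega_1,\Omega_2)}$ for tuples of bijections $f_i:\Omega_i\to\tilde\Omega_i$. - Axiom (D1): whenever $\Omega_1\amalg\Omega_2=\Omega=\tilde\Omega_1\amalg\tilde\Omega_2$, \[ \eta(F[\Omega_1]\times F[\Omega_2])\cap\eta(F[\tilde\Omega_1]\times F[\tilde\Omega_2])=\eta(\eta(F[\Omega_{11}]\times F[\Omega_{12}])\times\eta(F[\Omega_{21}]\times F[\Omega_{22}])), \] where $\Omega_{ij}=\Omega_i\cap\tilde\Omega_j$.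 $\eta(A\times B)$ denotes the image of $A\times B$ under the relevant $\eta$-map. $F$ is decomposable if some $F[\Omega]\ne\emptyset$ and $F$ admits a composition operator. -}

module Defs where

open import Data.Nat using (ℕ; _<_)
open import Data.Fin using (Fin)
open import Data.List using (List)
open import Data.List.Membership.Propositional using (_∈_)
open import Data.List.Relation.Unary.Linked using (Linked)
open import Data.Vec using (Vec; lookup)
open import Data.Product using (Σ; _×_; _,_; proj₁; proj₂; ∃-syntax)
open import Data.Sum using (_⊎_; inj₁; inj₂)
open import Data.Empty using (⊥)
open import Function.Bundles using (_⤖_; Bijection; _⇔_; Equivalence)
open import Relation.Binary.PropositionalEquality using (_≡_)

-- We use finite subsets of ℕ in a canonical form
-- (strictly increasing lists), so that two finite sets with the same
-- elements are literally equal; set operations (∪, ∩) on them are then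
-- well defined, as in the paper.  Every finite set is in bijection
-- with such a set, so the category is equivalent to 𝐒𝐞𝐭.

record FinSet : Set where
  constructor mkFinSet
  field
    elems  : List ℕ
    sorted : Linked _<_ elems

open FinSet public

Obj : ℕ → Set
Obj r = Vec FinSet r

module _ {r : ℕ} where

  -- x belongs to the i-th component of Ω
  -- (a record wrapper around list membership, for type inference)
  record Mem (Ω : Obj r) (i : Fin r) (x : ℕ) : Set where
    constructor mem
    field
      unmem : x ∈ elems (lookup Ω i)

  El : Obj r → Fin r → Set
  El Ω i = Σ ℕ (Mem Ω i)

  Hom : Obj r → Obj r → Set
  Hom Ω Ω' = (i : Fin r) → El Ω i ⤖ El Ω' i

  app : {Ω Ω' : Obj r} → Hom Ω Ω' → (i : Fin r) → El Ω i → El Ω' i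
  app f i = Bijection.to (f i)

  Disjoint : Obj r → Obj r → Set
  Disjoint A B = ∀ i x → Mem A i x → Mem B i x → ⊥

  IsUnion : Obj r → Obj r → Obj r → Set
  IsUnion A B U = ∀ i x → Mem U i x ⇔ (Mem A i x ⊎ Mem B i x)

  IsInter : Obj r → Obj r → Obj r → Set
  IsInter A B U = ∀ i x → Mem U i x ⇔ (Mem A i x × Mem B i x)

  IsCoproductMap : {A B U A' B' U' : Obj r} →
    Hom A A' → Hom B B' → Hom U U' → Set
  IsCoproductMap {A} {B} {U} f₁ f₂ f =
    (∀ i x (p : Mem A i x) (q : Mem U i x) →
       proj₁ (app f i (x , q)) ≡ proj₁ (app f₁ i (x , p))) ×
    (∀ i x (p : Mem B i x) (q : Mem U i x) →
       proj₁ (app f i (x , q)) ≡ proj₁ (app f₂ i (x , p)))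

  disj-∪ˡ : {A B C U : Obj r} → Disjoint A C → Disjoint B C →
            IsUnion A B U → Disjoint U C
  disj-∪ˡ dAC dBC u i x xU xC with Equivalence.to (u i x) xU
  ... | inj₁ xA = dAC i x xA xC
  ... | inj₂ xB = dBC i x xB xC

  disj-∪ʳ : {A B C U : Obj r} → Disjoint A B → Disjoint A C →
            IsUnion B C U → Disjoint A U
  disj-∪ʳ dAB dAC u i x xA xU with Equivalence.to (u i x) xU
  ... | inj₁ xB = dAB i x xA xB
  ... | inj₂ xC = dAC i x xA xC

  disj-∩ : {A B C P Q : Obj r} → Disjoint B C →
           IsInter A B P → IsInter A C Q → Disjoint P Q
  disj-∩ dBC p q i x xP xQ =
    dBC i x (proj₂ (Equivalence.to (p i x) xP)) (proj₂ (Equivalence.to (q i x) xQ))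

  ∩-split : {A B C U P Q : Obj r} →
            (∀ i x → Mem A i x → Mem U i x) → IsUnion B C U →
            IsInter A B P → IsInter A C Q → IsUnion P Q A
  ∩-split {A} {B} {C} {U} {P} {Q} sub uB p q i x =
    record { to = to ; from = from ; to-cong = λ { _≡_.refl → _≡_.refl }
           ; from-cong = λ { _≡_.refl → _≡_.refl } }
    where
    to : Mem A i x → Mem P i x ⊎ Mem Q i x
    to xA with Equivalence.to (uB i x) (sub i x xA)
    ... | inj₁ xB = inj₁ (Equivalence.from (p i x) (xA , xB))
    ... | inj₂ xC = inj₂ (Equivalence.from (q i x) (xA , xC))
    from : Mem P i x ⊎ Mem Q i x → Mem A i x
    from (inj₁ xP) = proj₁ (Equivalence.to (p i x) xP)
    from (inj₂ xQ) = proj₁ (Equivalence.to (q i x) xQ)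

  ∪-inl : {A B U : Obj r} → IsUnion A B U → ∀ i x → Mem A i x → Mem U i x
  ∪-inl u i x xA = Equivalence.from (u i x) (inj₁ xA)

  ∪-inr : {A B U : Obj r} → IsUnion A B U → ∀ i x → Mem B i x → Mem U i x
  ∪-inr u i x xB = Equivalence.from (u i x) (inj₂ xB)

record Species (r : ℕ) : Set₁ where
  field
    F₀     : Obj r → Set
    finite : ∀ Ω → ∃[ n ] (F₀ Ω ⤖ Fin n)
    F₁     : {Ω Ω' : Obj r} → Hom Ω Ω' → F₀ Ω → F₀ Ω'
    F-id   : {Ω : Obj r} (f : Hom Ω Ω) →
             (∀ i e → app f i e ≡ e) → ∀ a → F₁ f a ≡ a
    F-∘    : {Ω Ω' Ω'' : Obj r} (f : Hom Ω Ω') (g : Hom Ω' Ω'') (h : Hom Ω Ω'') →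
             (∀ i e → app h i e ≡ app g i (app f i e)) →
             ∀ a → F₁ h a ≡ F₁ g (F₁ f a)

-- Composition operators.  η is indexed by a disjoint pair (Ω₁,Ω₂)
-- and lands in F[Ω₁ ∐ Ω₂]; the union is given relationally (it is
-- unique because finite sets are canonical), and the proofs of
-- disjointness / union are irrelevant, so there is exactly one map per
-- disjoint pair.

record CompositionOperator {r : ℕ} (F : Species r) : Set where
  open Species F
  field
    η : {Ω₁ Ω₂ Ω : Obj r} → .(Disjoint Ω₁ Ω₂) → .(IsUnion Ω₁ Ω₂ Ω) →
        F₀ Ω₁ → F₀ Ω₂ → F₀ Ω

    injective : {Ω₁ Ω₂ Ω : Obj r} .(d : Disjoint Ω₁ Ω₂) .(u : IsUnion Ω₁ Ω₂ Ω)
                (a a' : F₀ Ω₁) (b b' : F₀ Ω₂) →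
                η d u a b ≡ η d u a' b' → (a ≡ a') × (b ≡ b')

    natural : {Ω₁ Ω₂ Ω Ω₁' Ω₂' Ω' : Obj r}
              .(d : Disjoint Ω₁ Ω₂) .(u : IsUnion Ω₁ Ω₂ Ω)
              .(d' : Disjoint Ω₁' Ω₂') .(u' : IsUnion Ω₁' Ω₂' Ω')
              (f₁ : Hom Ω₁ Ω₁') (f₂ : Hom Ω₂ Ω₂') (f : Hom Ω Ω') →
              IsCoproductMap f₁ f₂ f →
              ∀ a b → η d' u' (F₁ f₁ a) (F₁ f₂ b) ≡ F₁ f (η d u a b)

    D1 : {Ω₁ Ω₂ Ω̃₁ Ω̃₂ Ω Ω₁₁ Ω₁₂ Ω₂₁ Ω₂₂ : Obj r}
         (d : Disjoint Ω₁ Ω₂) (u : IsUnion Ω₁ Ω₂ Ω)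
         (d̃ : Disjoint Ω̃₁ Ω̃₂) (ũ : IsUnion Ω̃₁ Ω̃₂ Ω)
         (i₁₁ : IsInter Ω₁ Ω̃₁ Ω₁₁) (i₁₂ : IsInter Ω₁ Ω̃₂ Ω₁₂)
         (i₂₁ : IsInter Ω₂ Ω̃₁ Ω₂₁) (i₂₂ : IsInter Ω₂ Ω̃₂ Ω₂₂) →
         ∀ z → ((∃[ a ] ∃[ b ] η d u a b ≡ z) ×
                (∃[ a ] ∃[ b ] η d̃ ũ a b ≡ z)) ⇔
               (∃[ a ] ∃[ b ] ∃[ c ] ∃[ e ]
                  η d u (η (disj-∩ d̃ i₁₁ i₁₂) (∩-split (∪-inl u) ũ i₁₁ i₁₂) a b)
                        (η (disj-∩ d̃ i₂₁ i₂₂) (∩-split (∪-inr u) ũ i₂₁ i₂₂) c e)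
                  ≡ z)

-- F is decomposable (with composition operator η): some F[Ω] is
-- nonempty, and η is a composition operator for F.
Nonempty : {r : ℕ} → Species r → Set
Nonempty {r} F = ∃[ Ω ] Species.F₀ F Ω

module Submission where

-- Write η_{X,Y} for the component of η at a disjoint pair (X,Y).  Let
-- Ω = Ω₁ ∐ Ω₂ ∐ Ω₃ and consider the two decompositions (Ω₁₂, Ω₃) and
-- (Ω₁, Ω₂₃) of Ω.  Their pairwise intersections are Ω₁, Ω₂, ∅ and Ω₃,
-- so axiom (D1) identifies the common part of the images of η_{Ω₁₂,Ω₃}
-- and η_{Ω₁,Ω₂₃} with
--     η(η(F[Ω₁] × F[Ω₂]) × η(F[∅] × F[Ω₃]))   and with
--     η(η(F[Ω₁] × F[∅]) × η(F[Ω₂] × F[Ω₃])).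
-- The factors η(F[∅] × F[Ω₃]) and η(F[Ω₁] × F[∅]) are the whole of
-- F[Ω₃] resp. F[Ω₁]: F[∅] is inhabited (D1 applied to a decomposition
-- and itself produces an element of F[∅] from any value of η), and for
-- e ∈ F[∅] the map η(e, -) is an injective endomap of the finite set
-- F[Ω₃], hence surjective.  So both bracketings describe the common
-- part of the two images, and they therefore coincide.

open import Defs
open import Data.Nat using (ℕ; _≤_; suc)
open import Data.Nat.Properties using (n≮n)
open import Data.Fin using (Fin; zero; suc)
open import Data.Fin.Properties using (any?; _≟_; injective⇒≤)
open import Data.Vec using (replicate)
open import Data.Vec.Properties using (lookup-replicate)
open import Data.List using ([])
open import Data.List.Relation.Unary.Linked using ([])
open import Data.Product using (∃; ∃-syntax; _×_; _,_; proj₁; proj₂; swap)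
open import Data.Sum using (inj₁; inj₂)
open import Data.Empty using (⊥-elim)
open import Function using (_∘_)
open import Function.Bundles using (_⇔_; mk⇔; Equivalence; _⤖_; Bijection)
open import Function.Properties.Equivalence using () renaming (trans to ⇔-trans; sym to ⇔-sym)
open import Relation.Nullary using (¬_; yes; no)
open import Relation.Binary.PropositionalEquality using (_≡_; refl; sym; trans; cong)

-- Pigeonhole, surjective form: an injective map Fin n → Fin n hits
-- every point (otherwise it would yield an injection Fin (1+n) → Fin n).
injective⇒surjective-Fin : ∀ {n} (h : Fin n → Fin n) →
  (∀ x y → h x ≡ h y → x ≡ y) → ∀ y → ∃ λ x → h x ≡ y
injective⇒surjective-Fin {n} h h-inj y with any? (λ x → h x ≟ y)
... | yes hit = hit
... | no miss = ⊥-elim (n≮n n (injective⇒≤ {f = extend} extend-injective))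
  where
  extend : Fin (suc n) → Fin n
  extend zero    = y
  extend (suc x) = h x

  extend-injective : ∀ {a b} → extend a ≡ extend b → a ≡ b
  extend-injective {zero}  {zero}  _ = refl
  extend-injective {zero}  {suc b} e = ⊥-elim (miss (b , sym e))
  extend-injective {suc a} {zero}  e = ⊥-elim (miss (a , e))
  extend-injective {suc a} {suc b} e = cong suc (h-inj a b e)

-- The same for any finite type, by conjugating with a bijection to Fin n.
injective⇒surjective : ∀ {A : Set} {n} → A ⤖ Fin n → (g : A → A) →
  (∀ x y → g x ≡ g y → x ≡ y) → ∀ c → ∃ λ x → g x ≡ c
injective⇒surjective {A} {n} bij g g-inj c =
  let (k , hk≡tc) = injective⇒surjective-Fin h h-injective (t c)
  in s k , t-injective hk≡tc
  where
  t : A → Fin n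
  t = Bijection.to bij

  t-injective : ∀ {x y} → t x ≡ t y → x ≡ y
  t-injective = Bijection.injective bij

  s : Fin n → A
  s k = proj₁ (Bijection.strictlySurjective bij k)

  t∘s : ∀ k → t (s k) ≡ k
  t∘s k = proj₂ (Bijection.strictlySurjective bij k)

  h : Fin n → Fin n
  h = t ∘ g ∘ s

  h-injective : ∀ x y → h x ≡ h y → x ≡ y
  h-injective x y e =
    trans (sym (t∘s x)) (trans (cong t (g-inj _ _ (t-injective e))) (t∘s y))

module SetAlgebra {r : ℕ} where

  _⊆_ : Obj r → Obj r → Set
  A ⊆ B = ∀ i x → Mem A i x → Mem B i x

  ∅ : Obj r
  ∅ = replicate r (mkFinSet [] [])

  ∉∅ : ∀ i x → ¬ Mem ∅ i x
  ∉∅ i x (mem x∈) rewrite lookup-replicate i (mkFinSet [] []) with x∈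
  ... | ()

  ∅-disjoint : {A : Obj r} → Disjoint ∅ A
  ∅-disjoint i x x∈∅ _ = ∉∅ i x x∈∅

  disjoint-sym : {A B : Obj r} → Disjoint A B → Disjoint B A
  disjoint-sym d i x p q = d i x q p

  ∅-unionˡ : {A : Obj r} → IsUnion ∅ A A
  ∅-unionˡ i x = mk⇔ inj₂ λ { (inj₁ p) → ⊥-elim (∉∅ i x p) ; (inj₂ p) → p }

  ∅-unionʳ : {A : Obj r} → IsUnion A ∅ A
  ∅-unionʳ i x = mk⇔ inj₁ λ { (inj₁ p) → p ; (inj₂ p) → ⊥-elim (∉∅ i x p) }

  ∩-sym : {A B P : Obj r} → IsInter A B P → IsInter B A P
  ∩-sym p i x = mk⇔ (swap ∘ Equivalence.to (p i x)) (Equivalence.from (p i x) ∘ swap)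

  ∩-self : {A : Obj r} → IsInter A A A
  ∩-self i x = mk⇔ (λ p → p , p) proj₁

  ∩-disjoint : {A B : Obj r} → Disjoint A B → IsInter A B ∅
  ∩-disjoint d i x =
    mk⇔ (λ p → ⊥-elim (∉∅ i x p)) (λ { (p , q) → ⊥-elim (d i x p q) })

  ∩-⊆ : {A B : Obj r} → A ⊆ B → IsInter A B A
  ∩-⊆ A⊆B i x = mk⇔ (λ p → p , A⊆B i x p) proj₁

  ∩-middle : {Ω₁ Ω₂ Ω₃ Ω₁₂ Ω₂₃ : Obj r} →
    Disjoint Ω₁ Ω₂ → Disjoint Ω₁ Ω₃ →
    IsUnion Ω₁ Ω₂ Ω₁₂ → IsUnion Ω₂ Ω₃ Ω₂₃ → IsInter Ω₁₂ Ω₂₃ Ω₂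
  ∩-middle {Ω₁} {Ω₂} {Ω₃} {Ω₁₂} {Ω₂₃} d₁₂ d₁₃ u₁₂ u₂₃ i x =
    mk⇔ (λ p → ∪-inr u₁₂ i x p , ∪-inl u₂₃ i x p) from
    where
    from : Mem Ω₁₂ i x × Mem Ω₂₃ i x → Mem Ω₂ i x
    from (p , q) with Equivalence.to (u₁₂ i x) p | Equivalence.to (u₂₃ i x) q
    ... | inj₂ x∈Ω₂ | _         = x∈Ω₂
    ... | inj₁ x∈Ω₁ | inj₁ x∈Ω₂ = ⊥-elim (d₁₂ i x x∈Ω₁ x∈Ω₂)
    ... | inj₁ x∈Ω₁ | inj₂ x∈Ω₃ = ⊥-elim (d₁₃ i x x∈Ω₁ x∈Ω₃)

open SetAlgebra

module Units {r : ℕ} (F : Species r) (C : CompositionOperator F) where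
  open Species F
  open CompositionOperator C

  -- (D1) for (A,B) against itself: η(F[A] × F[B]) = η(η(F[A] × F[∅]) × η(F[∅] × F[B]))
  emptyElement : {A B U : Obj r} → Disjoint A B → IsUnion A B U →
    F₀ A → F₀ B → F₀ ∅
  emptyElement d u a b =
    proj₁ (proj₂ (Equivalence.to
      (D1 d u d u ∩-self (∩-disjoint d) (∩-disjoint (disjoint-sym d)) ∩-self (η d u a b))
      ((a , b , refl) , (a , b , refl))))

  -- η(e, -) : F[A] → F[A] is injective, hence onto since F[A] is finite
  unitˡ-surjective : {A : Obj r} (e : F₀ ∅) (c : F₀ A) →
    ∃ λ c' → η (∅-disjoint {A = A}) ∅-unionˡ e c' ≡ c
  unitˡ-surjective {A} e = injective⇒surjective (proj₂ (finite A))
    (η (∅-disjoint {A = A}) ∅-unionˡ e)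
    (λ x y eq → proj₂ (injective (∅-disjoint {A = A}) ∅-unionˡ e e x y eq))

  unitʳ-surjective : {A : Obj r} (e : F₀ ∅) (a : F₀ A) →
    ∃ λ a' → η (disjoint-sym (∅-disjoint {A = A})) ∅-unionʳ a' e ≡ a
  unitʳ-surjective {A} e = injective⇒surjective (proj₂ (finite A))
    (λ x → η (disjoint-sym (∅-disjoint {A = A})) ∅-unionʳ x e)
    (λ x y eq → proj₁ (injective (disjoint-sym (∅-disjoint {A = A})) ∅-unionʳ x y e e eq))

module ThreeParts {r : ℕ} (F : Species r) (C : CompositionOperator F)
    {Ω₁ Ω₂ Ω₃ Ω₁₂ Ω₂₃ Ω : Obj r}
    (d₁₂ : Disjoint Ω₁ Ω₂) (d₁₃ : Disjoint Ω₁ Ω₃) (d₂₃ : Disjoint Ω₂ Ω₃)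
    (u₁₂ : IsUnion Ω₁ Ω₂ Ω₁₂) (u₂₃ : IsUnion Ω₂ Ω₃ Ω₂₃)
    (u₁₂,₃ : IsUnion Ω₁₂ Ω₃ Ω) (u₁,₂₃ : IsUnion Ω₁ Ω₂₃ Ω) where
  open Species F
  open CompositionOperator C
  open Units F C

  d₁₂,₃ : Disjoint Ω₁₂ Ω₃
  d₁₂,₃ = disj-∪ˡ d₁₃ d₂₃ u₁₂

  d₁,₂₃ : Disjoint Ω₁ Ω₂₃
  d₁,₂₃ = disj-∪ʳ d₁₂ d₁₃ u₂₃

  LeftBracketed : F₀ Ω → Set
  LeftBracketed z = ∃[ a ] ∃[ b ] ∃[ c ] η d₁₂,₃ u₁₂,₃ (η d₁₂ u₁₂ a b) c ≡ z

  RightBracketed : F₀ Ω → Set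
  RightBracketed z = ∃[ a ] ∃[ b ] ∃[ c ] η d₁,₂₃ u₁,₂₃ a (η d₂₃ u₂₃ b c) ≡ z

  InBothImages : F₀ Ω → Set
  InBothImages z = (∃[ a ] ∃[ b ] η d₁₂,₃ u₁₂,₃ a b ≡ z) ×
                   (∃[ a ] ∃[ b ] η d₁,₂₃ u₁,₂₃ a b ≡ z)

  -- (D1) for (Ω₁₂, Ω₃) against (Ω₁, Ω₂₃); the intersections are Ω₁, Ω₂, ∅, Ω₃
  D1-left : ∀ z → InBothImages z ⇔
    (∃[ a ] ∃[ b ] ∃[ e ] ∃[ c ]
       η d₁₂,₃ u₁₂,₃ (η d₁₂ u₁₂ a b) (η ∅-disjoint ∅-unionˡ e c) ≡ z)
  D1-left = D1 d₁₂,₃ u₁₂,₃ d₁,₂₃ u₁,₂₃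
    (∩-sym (∩-⊆ (∪-inl u₁₂))) (∩-middle d₁₂ d₁₃ u₁₂ u₂₃)
    (∩-disjoint (disjoint-sym d₁₃)) (∩-⊆ (∪-inr u₂₃))

  -- (D1) for (Ω₁, Ω₂₃) against (Ω₁₂, Ω₃); the intersections are Ω₁, ∅, Ω₂, Ω₃
  D1-right : ∀ z →
    ((∃[ a ] ∃[ b ] η d₁,₂₃ u₁,₂₃ a b ≡ z) × (∃[ a ] ∃[ b ] η d₁₂,₃ u₁₂,₃ a b ≡ z)) ⇔
    (∃[ a ] ∃[ e ] ∃[ b ] ∃[ c ]
       η d₁,₂₃ u₁,₂₃ (η (disjoint-sym ∅-disjoint) ∅-unionʳ a e) (η d₂₃ u₂₃ b c) ≡ z)
  D1-right = D1 d₁,₂₃ u₁,₂₃ d₁₂,₃ u₁₂,₃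
    (∩-⊆ (∪-inl u₁₂)) (∩-disjoint d₁₃)
    (∩-sym (∩-middle d₁₂ d₁₃ u₁₂ u₂₃)) (∩-sym (∩-⊆ (∪-inr u₂₃)))

  left⇔both : ∀ z → LeftBracketed z ⇔ InBothImages z
  left⇔both z = mk⇔ to from
    where
    to : LeftBracketed z → InBothImages z
    to (a , b , c , ≡z) =
      let e = emptyElement d₁₂ u₁₂ a b
          (c' , ec'≡c) = unitˡ-surjective e c
      in Equivalence.from (D1-left z)
           (a , b , e , c' , trans (cong (η d₁₂,₃ u₁₂,₃ (η d₁₂ u₁₂ a b)) ec'≡c) ≡z)
    from : InBothImages z → LeftBracketed z
    from both =
      let (a , b , e , c , ≡z) = Equivalence.to (D1-left z) both
      in a , b , η ∅-disjoint ∅-unionˡ e c , ≡z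

  right⇔both : ∀ z → RightBracketed z ⇔ InBothImages z
  right⇔both z = mk⇔ to from
    where
    to : RightBracketed z → InBothImages z
    to (a , b , c , ≡z) =
      let e = emptyElement d₂₃ u₂₃ b c
          (a' , a'e≡a) = unitʳ-surjective e a
      in swap (Equivalence.from (D1-right z)
           (a' , e , b , c , trans (cong (λ x → η d₁,₂₃ u₁,₂₃ x (η d₂₃ u₂₃ b c)) a'e≡a) ≡z))
    from : InBothImages z → RightBracketed z
    from both =
      let (a , e , b , c , ≡z) = Equivalence.to (D1-right z) (swap both)
      in η (disjoint-sym ∅-disjoint) ∅-unionʳ a e , b , c , ≡z

-- Lemma 3.3: both bracketings equal the common part of the two images.
-- (Neither r ≥ 1 nor the nonemptiness of F is needed: a value of η
-- already provides an element of F[∅].)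
lemma3p3 : (r : ℕ) → 1 ≤ r → (F : Species r) → Nonempty F →
    (C : CompositionOperator F) →
    let open CompositionOperator C in
    {Ω₁ Ω₂ Ω₃ Ω₁₂ Ω₂₃ Ω : Obj r} →
    (d₁₂ : Disjoint Ω₁ Ω₂) (d₁₃ : Disjoint Ω₁ Ω₃) (d₂₃ : Disjoint Ω₂ Ω₃) →
    (u₁₂ : IsUnion Ω₁ Ω₂ Ω₁₂) (u₂₃ : IsUnion Ω₂ Ω₃ Ω₂₃) →
    (u₁₂,₃ : IsUnion Ω₁₂ Ω₃ Ω) (u₁,₂₃ : IsUnion Ω₁ Ω₂₃ Ω) →
    ∀ z →
    (∃[ a ] ∃[ b ] ∃[ c ] η (disj-∪ˡ d₁₃ d₂₃ u₁₂) u₁₂,₃ (η d₁₂ u₁₂ a b) c ≡ z) ⇔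
    (∃[ a ] ∃[ b ] ∃[ c ] η (disj-∪ʳ d₁₂ d₁₃ u₂₃) u₁,₂₃ a (η d₂₃ u₂₃ b c) ≡ z)
lemma3p3 _ _ F _ C d₁₂ d₁₃ d₂₃ u₁₂ u₂₃ u₁₂,₃ u₁,₂₃ z =
  ⇔-trans (left⇔both z) (⇔-sym (right⇔both z))
  where open ThreeParts F C d₁₂ d₁₃ d₂₃ u₁₂ u₂₃ u₁₂,₃ u₁,₂₃
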